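{- Let $C_n$ be the cycle of length $n \geq 4$. Then $\mathcal{D}_{\mathrm{lir}}(C_n) = 0$ if $n \equiv 0 \pmod 4$, $\mathcal{D}_{\mathrm{lir}}(C_n) = 1$ if $n \equiv 1 \pmod 4$, and $\mathcal{D}_{\mathrm{lir}}(C_n) = 2$ if $n \equiv 2$ or $3 \pmod 4$.
   Context: A (multi)graph is locally irregular if the two endvertices of every edge have different degrees (degrees in multigraphs count parallel edges with multiplicity). For a graph $G$ and a set $E_d \subseteq E(G)$, $G + E_d$ denotes the multigraph obtained from $G$ by replacing each edge of $E_d$ by two parallel edges. For a connected graph $G$ not isomorphic to $K_2$ or $K_3$, $\mathcal{D}_{\mathrm{lir}}(G)$ is the minimum size of a set $E_d \subseteq E(G)$ such that the edges of $G+E_d$ can be colored with at most two colors so that each color class induces a locally irregular sub(multi)graph and any two parallel edges receive the same color. -}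

module Defs where

open import Data.Nat using (ℕ; zero; suc; _+_; _≤_)
open import Data.Nat.DivMod using (_mod_)
open import Data.Fin using (Fin; toℕ; _≟_)
import Data.Fin as F
open import Data.Bool using (Bool; true; false; if_then_else_)
open import Data.Product using (_×_; _,_; proj₁; proj₂; Σ; ∃)
open import Relation.Nullary using (¬_; does)
open import Relation.Binary.PropositionalEquality using (_≡_; _≢_)

sumFin : (m : ℕ) → (Fin m → ℕ) → ℕ
sumFin zero    f = 0
sumFin (suc m) f = f F.zero + sumFin m (λ i → f (F.suc i))

record Graph : Set where
  field
    nV   : ℕ
    nE   : ℕ
    ends : Fin nE → Fin nV × Fin nV
open Graph public

Cycle : ℕ → Graph
Cycle zero    = record { nV = 0 ; nE = 0 ; ends = λ () }
Cycle (suc k) = record { nV = suc k ; nE = suc k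
                       ; ends = λ i → i , (suc (toℕ i)) mod (suc k) }

EdgeSet : Graph → Set
EdgeSet G = Fin (nE G) → Bool

size : (G : Graph) → EdgeSet G → ℕ
size G Ed = sumFin (nE G) (λ e → if Ed e then 1 else 0)

-- Multiplicity of an edge of G in G + E_d.
mult : (G : Graph) → EdgeSet G → Fin (nE G) → ℕ
mult G Ed e = if Ed e then 2 else 1

-- Number of endpoints of edge e equal to v (a loop would count twice).
incid : (G : Graph) → Fin (nE G) → Fin (nV G) → ℕ
incid G e v = (if does (proj₁ (ends G e) ≟ v) then 1 else 0)
            + (if does (proj₂ (ends G e) ≟ v) then 1 else 0)

-- A 2-colouring of G + E_d in which parallel edges get the same colour is a
-- colouring of E(G).  Degree of v in the colour class c of G + E_d
-- (parallel edges counted with multiplicity):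
degC : (G : Graph) → EdgeSet G → (Fin (nE G) → Bool) → Bool → Fin (nV G) → ℕ
degC G Ed col c v =
  sumFin (nE G) (λ e → if does (Data.Bool._≟_ (col e) c)
                         then mult G Ed e * incid G e v else 0)
  where open import Data.Nat using (_*_)
        import Data.Bool

LocIrrColouring : (G : Graph) → EdgeSet G → (Fin (nE G) → Bool) → Set
LocIrrColouring G Ed col =
  ∀ e → degC G Ed col (col e) (proj₁ (ends G e)) ≢ degC G Ed col (col e) (proj₂ (ends G e))

Good : (G : Graph) → EdgeSet G → Set
Good G Ed = Σ (Fin (nE G) → Bool) (LocIrrColouring G Ed)

DlirIs : Graph → ℕ → Set
DlirIs G k = (Σ (EdgeSet G) λ Ed → size G Ed ≡ k × Good G Ed)
           × (∀ Ed → Good G Ed → k ≤ size G Ed)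

-- On a cycle, vertex v is incident to the edges v and prv v, so an edge e is irregular in its colour
-- class iff its two neighbouring edges have different weights in that class (the multiplicity if the
-- edge has e's colour, 0 otherwise).  Hence there are never two colour changes in a row, and an edge
-- whose neighbours both share its colour has exactly one doubled neighbour.  If B is the number of
-- such edges and Z the (even) number of colour changes, then n = B + 2Z, so n ≡ B (mod 4).  With no
-- doubled edge B = 0; with a single doubled edge j at most one neighbour of j is counted by B (if both
-- were, j itself would have both neighbours in its colour and no doubled neighbour), so B ≤ 1.  This
-- gives D_lir(C_n) ≥ min (n mod 4, 2); the colouring 1100 1100 …, with one or two edges doubled where
-- the pattern wraps around, attains it.

module Submission where

open import Defs
open import Data.Nat using (ℕ; zero; suc; _+_; _*_; _≤_; _<_; _%_; _/_; _⊓_; _≡ᵇ_; _<ᵇ_; z≤n; s≤s)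
open import Data.Nat.Properties
  using ( module ≤-Reasoning; _≤?_; ≰⇒>; ≤-trans; ≤-reflexive; 1+n≰n; 1+n≢n; m≤n+m; n≤0⇒n≡0
        ; m≤n⇒m<n∨m≡n; m⊓n≤m; m⊓n≤n; +-identityʳ; +-comm; +-assoc; +-cancelˡ-≡
        ; *-comm; *-identityʳ; *-zeroʳ; *-distribˡ-+; +-0-commutativeMonoid )
open import Data.Fin using (Fin; zero; suc; toℕ; fromℕ; inject₁; _≟_)
open import Data.Fin.Properties
  using (suc-injective; toℕ-injective; toℕ-fromℕ; toℕ-inject₁; toℕ-fromℕ<; toℕ<n)
open import Data.Fin.Permutation using (Permutation′; permutation; flip; _⟨$⟩ʳ_)
open import Data.Fin.Relation.Unary.Top using (view; ‵fromℕ; ‵inject₁)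
open import Data.Nat.Divisibility using (_∣_; divides; ∣m+n∣m⇒∣n)
open import Data.Nat.DivMod using (_mod_; m≥n⇒m/n>0; m≡m%n+[m/n]*n; m%n<n; m<n⇒m%n≡m; n%n≡0; [m+kn]%n≡m%n)
import Data.Bool as Bool
open Bool using (Bool; true; false; if_then_else_; not; _∧_; _∨_)
open import Data.Bool.Properties using (∧-conicalˡ; ∧-conicalʳ)
open import Data.Product using (_×_; _,_; Σ; ∃)
open import Data.Sum using (_⊎_; inj₁; inj₂; [_,_])
open import Data.Empty using (⊥; ⊥-elim)
open import Function using (_∘_; _⇔_; mk⇔; Equivalence)
open import Relation.Nullary using (does; yes; no)
open import Relation.Binary.PropositionalEquality using (_≡_; _≢_; refl; sym; trans; cong; cong₂; subst; subst₂)
open import Relation.Binary.PropositionalEquality.Properties using (module ≡-Reasoning)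
open import Algebra.Properties.CommutativeMonoid.Sum +-0-commutativeMonoid
  using (sum; ∑-distrib-+; sum-permute)

private
  variable
    m : ℕ

sumFin≡sum : ∀ m (f : Fin m → ℕ) → sumFin m f ≡ sum f
sumFin≡sum zero    f = refl
sumFin≡sum (suc m) f = cong (f zero +_) (sumFin≡sum m (f ∘ suc))

sumFin-cong : ∀ m {f g : Fin m → ℕ} → (∀ e → f e ≡ g e) → sumFin m f ≡ sumFin m g
sumFin-cong zero    f≗g = refl
sumFin-cong (suc m) f≗g = cong₂ _+_ (f≗g zero) (sumFin-cong m (f≗g ∘ suc))

sumFin-+ : ∀ m (f g : Fin m → ℕ) → sumFin m (λ e → f e + g e) ≡ sumFin m f + sumFin m g
sumFin-+ m f g rewrite sumFin≡sum m (λ e → f e + g e) | sumFin≡sum m f | sumFin≡sum m g =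
  ∑-distrib-+ f g

sumFin-permute : ∀ m (f : Fin m → ℕ) (π : Permutation′ m) → sumFin m (f ∘ (π ⟨$⟩ʳ_)) ≡ sumFin m f
sumFin-permute m f π rewrite sumFin≡sum m (f ∘ (π ⟨$⟩ʳ_)) | sumFin≡sum m f = sym (sum-permute f π)

sumFin-zero : ∀ m → sumFin m (λ _ → 0) ≡ 0
sumFin-zero zero    = refl
sumFin-zero (suc m) = sumFin-zero m

ind : Bool → ℕ
ind b = if b then 1 else 0

count : ∀ m → (Fin m → Bool) → ℕ
count m f = sumFin m (ind ∘ f)

count-allFalse : ∀ m {f : Fin m → Bool} → (∀ e → f e ≡ false) → count m f ≡ 0
count-allFalse m f≡false = trans (sumFin-cong m (cong ind ∘ f≡false)) (sumFin-zero m)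

count-const-true : ∀ m → count m (λ _ → true) ≡ m
count-const-true zero    = refl
count-const-true (suc m) = cong suc (count-const-true m)

count-true : ∀ m {f : Fin m → Bool} {a} → f a ≡ true → 1 ≤ count m f
count-true (suc m) {f} {zero}  fa≡true rewrite fa≡true = s≤s z≤n
count-true (suc m) {f} {suc a} fa≡true with f zero
... | true  = s≤s z≤n
... | false = count-true m fa≡true

count≡0⇒allFalse : ∀ m {f : Fin m → Bool} → count m f ≡ 0 → ∀ e → f e ≡ false
count≡0⇒allFalse m {f} count≡0 e with f e in fe≡true
... | false = refl
... | true  with () ← ≤-trans (count-true m fe≡true) (≤-reflexive count≡0)

two-true⇒2≤count : ∀ m {f : Fin m → Bool} {a b} → a ≢ b → f a ≡ true → f b ≡ true → 2 ≤ count m f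
two-true⇒2≤count (suc m)     {a = zero}  {zero}  a≢b _  _  = ⊥-elim (a≢b refl)
two-true⇒2≤count (suc m) {f} {a = zero}  {suc b} _   fa fb rewrite fa = s≤s (count-true m fb)
two-true⇒2≤count (suc m) {f} {a = suc a} {zero}  _   fa fb rewrite fb = s≤s (count-true m fa)
two-true⇒2≤count (suc m) {f} {a = suc a} {suc b} a≢b fa fb =
  ≤-trans (two-true⇒2≤count m (a≢b ∘ cong suc) fa fb) (m≤n+m _ (ind (f zero)))

count≤1⇒unique : ∀ m {f : Fin m → Bool} → count m f ≤ 1 →
                 ∀ {a b} → f a ≡ true → f b ≡ true → a ≡ b
count≤1⇒unique m c≤1 {a} {b} fa fb with a ≟ b
... | yes a≡b = a≡b
... | no  a≢b = ⊥-elim (1+n≰n (≤-trans (two-true⇒2≤count m a≢b fa fb) c≤1))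

unique⇒count≤1 : ∀ m {f : Fin m → Bool} → (∀ {a b} → f a ≡ true → f b ≡ true → a ≡ b) →
                 count m f ≤ 1
unique⇒count≤1 zero    uniq = z≤n
unique⇒count≤1 (suc m) {f} uniq with f zero in f0≡true
... | true  = ≤-reflexive (cong suc (count-allFalse m others))
  where
  others : ∀ e → f (suc e) ≡ false
  others e with f (suc e) in fe≡true
  ... | true  with () ← uniq f0≡true fe≡true
  ... | false = refl
... | false = unique⇒count≤1 m (λ fa fb → suc-injective (uniq fa fb))

sumFin-sift : ∀ m (g : Fin m → ℕ) v → sumFin m (λ e → g e * ind (does (e ≟ v))) ≡ g v
sumFin-sift (suc m) g zero = begin
  g zero * 1 + sumFin m (λ e → g (suc e) * 0)
    ≡⟨ cong₂ _+_ (*-identityʳ _) (sumFin-cong m (λ e → *-zeroʳ (g (suc e)))) ⟩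
  g zero + sumFin m (λ _ → 0)
    ≡⟨ cong (g zero +_) (sumFin-zero m) ⟩
  g zero + 0
    ≡⟨ +-identityʳ _ ⟩
  g zero ∎
  where open ≡-Reasoning
sumFin-sift (suc m) g (suc v) =
  trans (cong (_+ sumFin m (λ e → g (suc e) * ind (does (e ≟ v)))) (*-zeroʳ (g zero)))
        (sumFin-sift m (g ∘ suc) v)

-- Definitionally the second endpoint of edge i of Cycle (suc m).
nxt : Fin (suc m) → Fin (suc m)
nxt {m} i = suc (toℕ i) mod suc m

prv : Fin (suc m) → Fin (suc m)
prv zero    = fromℕ _
prv (suc i) = inject₁ i

toℕ-nxt : (i : Fin (suc m)) → toℕ (nxt i) ≡ suc (toℕ i) % suc m
toℕ-nxt {m} i = toℕ-fromℕ< (m%n<n (suc (toℕ i)) (suc m))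

nxt-inject₁ : (i : Fin m) → nxt (inject₁ i) ≡ suc i
nxt-inject₁ {m} i = toℕ-injective (begin
  toℕ (nxt (inject₁ i))         ≡⟨ toℕ-nxt (inject₁ i) ⟩
  suc (toℕ (inject₁ i)) % suc m ≡⟨ cong (λ x → suc x % suc m) (toℕ-inject₁ i) ⟩
  suc (toℕ i) % suc m           ≡⟨ m<n⇒m%n≡m (s≤s (toℕ<n i)) ⟩
  suc (toℕ i)                   ∎)
  where open ≡-Reasoning

nxt-fromℕ : ∀ m → nxt (fromℕ m) ≡ zero
nxt-fromℕ m = toℕ-injective (begin
  toℕ (nxt (fromℕ m))         ≡⟨ toℕ-nxt (fromℕ m) ⟩
  suc (toℕ (fromℕ m)) % suc m ≡⟨ cong (λ x → suc x % suc m) (toℕ-fromℕ m) ⟩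
  suc m % suc m               ≡⟨ n%n≡0 (suc m) ⟩
  0                           ∎)
  where open ≡-Reasoning

nxt-prv : (v : Fin (suc m)) → nxt (prv v) ≡ v
nxt-prv {m} zero = nxt-fromℕ m
nxt-prv (suc i)  = nxt-inject₁ i

prv-nxt : (v : Fin (suc m)) → prv (nxt v) ≡ v
prv-nxt {m} v with view v
... | ‵fromℕ     = cong prv (nxt-fromℕ m)
... | ‵inject₁ i = cong prv (nxt-inject₁ i)

rotation : Permutation′ (suc m)
rotation = permutation nxt prv nxt-prv prv-nxt

prv≢ : 1 ≤ m → (v : Fin (suc m)) → prv v ≢ v
prv≢ (s≤s _) zero    ()
prv≢ (s≤s _) (suc i) prv≡ = 1+n≢n (sym (trans (sym (toℕ-inject₁ i)) (cong toℕ prv≡)))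

nxt≢ : 1 ≤ m → (v : Fin (suc m)) → nxt v ≢ v
nxt≢ 1≤m v nxt≡ = prv≢ 1≤m v (trans (cong prv (sym nxt≡)) (prv-nxt v))

weight : EdgeSet (Cycle (suc m)) → (Fin (suc m) → Bool) → Bool → Fin (suc m) → ℕ
weight {m} Ed col c e = if does (col e Bool.≟ c) then mult (Cycle (suc m)) Ed e else 0

degC-Cycle : (Ed : EdgeSet (Cycle (suc m))) (col : Fin (suc m) → Bool) (c : Bool) (v : Fin (suc m)) →
             degC (Cycle (suc m)) Ed col c v ≡ weight Ed col c v + weight Ed col c (prv v)
degC-Cycle {m} Ed col c v = begin
  degC (Cycle (suc m)) Ed col c v
    ≡⟨ sumFin-cong (suc m) (λ e → if-*ʳ (does (col e Bool.≟ c)) (mult (Cycle (suc m)) Ed e) (incid′ e)) ⟩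
  sumFin (suc m) (λ e → w e * (δ e + δ (nxt e)))
    ≡⟨ sumFin-cong (suc m) (λ e → *-distribˡ-+ (w e) (δ e) (δ (nxt e))) ⟩
  sumFin (suc m) (λ e → w e * δ e + w e * δ (nxt e))
    ≡⟨ sumFin-+ (suc m) (λ e → w e * δ e) (λ e → w e * δ (nxt e)) ⟩
  sumFin (suc m) (λ e → w e * δ e) + sumFin (suc m) (λ e → w e * δ (nxt e))
    ≡⟨ cong (sumFin (suc m) (λ e → w e * δ e) +_)
            (sym (sumFin-permute (suc m) (λ e → w e * δ (nxt e)) (flip rotation))) ⟩
  sumFin (suc m) (λ e → w e * δ e) + sumFin (suc m) (λ e → w (prv e) * δ (nxt (prv e)))
    ≡⟨ cong (sumFin (suc m) (λ e → w e * δ e) +_)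
            (sumFin-cong (suc m) (λ e → cong (λ x → w (prv e) * δ x) (nxt-prv e))) ⟩
  sumFin (suc m) (λ e → w e * δ e) + sumFin (suc m) (λ e → w (prv e) * δ e)
    ≡⟨ cong₂ _+_ (sumFin-sift (suc m) w v) (sumFin-sift (suc m) (w ∘ prv) v) ⟩
  w v + w (prv v) ∎
  where
  open ≡-Reasoning
  w : Fin (suc m) → ℕ
  w = weight Ed col c
  δ : Fin (suc m) → ℕ
  δ e = ind (does (e ≟ v))
  incid′ : Fin (suc m) → ℕ
  incid′ e = δ e + δ (nxt e)
  if-*ʳ : ∀ b x y → (if b then x * y else 0) ≡ (if b then x else 0) * y
  if-*ʳ true  x y = refl
  if-*ʳ false x y = refl

NeighbourWeightsDiffer : EdgeSet (Cycle (suc m)) → (Fin (suc m) → Bool) → Set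
NeighbourWeightsDiffer Ed col = ∀ e → weight Ed col (col e) (prv e) ≢ weight Ed col (col e) (nxt e)

degC-ends-≡⇔ : (Ed : EdgeSet (Cycle (suc m))) (col : Fin (suc m) → Bool) (c : Bool) (e : Fin (suc m)) →
               degC (Cycle (suc m)) Ed col c e ≡ degC (Cycle (suc m)) Ed col c (nxt e)
               ⇔ weight Ed col c (prv e) ≡ weight Ed col c (nxt e)
degC-ends-≡⇔ {m} Ed col c e = mk⇔
  (λ deg≡ → +-cancelˡ-≡ (w e) _ _ (trans (sym (degC-Cycle Ed col c e)) (trans deg≡ deg-nxt)))
  (λ w≡ → trans (degC-Cycle Ed col c e) (trans (cong (w e +_) w≡) (sym deg-nxt)))
  where
  w : Fin (suc m) → ℕ
  w = weight Ed col c
  deg-nxt : degC (Cycle (suc m)) Ed col c (nxt e) ≡ w e + w (nxt e)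
  deg-nxt = trans (degC-Cycle Ed col c (nxt e))
                  (trans (+-comm (w (nxt e)) _) (cong (λ x → w x + w (nxt e)) (prv-nxt e)))

locIrr⇔neighbourWeightsDiffer : (Ed : EdgeSet (Cycle (suc m))) (col : Fin (suc m) → Bool) →
                                LocIrrColouring (Cycle (suc m)) Ed col ⇔ NeighbourWeightsDiffer Ed col
locIrr⇔neighbourWeightsDiffer Ed col = mk⇔
  (λ locIrr e → locIrr e ∘ Equivalence.from (degC-ends-≡⇔ Ed col (col e) e))
  (λ differ e → differ e ∘ Equivalence.to (degC-ends-≡⇔ Ed col (col e) e))

2∣n+n : ∀ n → 2 ∣ n + n
2∣n+n n = divides n (trans (cong (n +_) (sym (+-identityʳ n))) (*-comm 2 n))

count-mismatches-even : ∀ m (π : Permutation′ m) (b : Fin m → Bool) →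
                        2 ∣ count m (λ e → not (does (b (π ⟨$⟩ʳ e) Bool.≟ b e)))
count-mismatches-even m π b =
  ∣m+n∣m⇒∣n (subst (2 ∣_) (sym mismatches+2both) (2∣n+n (count m b))) (2∣n+n (count m bothTrue))
  where
  mismatch bothTrue : Fin m → Bool
  mismatch e = not (does (b (π ⟨$⟩ʳ e) Bool.≟ b e))
  bothTrue e = b (π ⟨$⟩ʳ e) ∧ b e
  pointwise : ∀ x y → ind (x ∧ y) + ind (x ∧ y) + ind (not (does (x Bool.≟ y))) ≡ ind x + ind y
  pointwise false false = refl
  pointwise false true  = refl
  pointwise true  false = refl
  pointwise true  true  = refl
  mismatches+2both : count m bothTrue + count m bothTrue + count m mismatch ≡ count m b + count m b
  mismatches+2both = begin
    count m bothTrue + count m bothTrue + count m mismatch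
      ≡⟨ cong (_+ count m mismatch) (sym (sumFin-+ m (ind ∘ bothTrue) (ind ∘ bothTrue))) ⟩
    sumFin m (λ e → ind (bothTrue e) + ind (bothTrue e)) + count m mismatch
      ≡⟨ sym (sumFin-+ m (λ e → ind (bothTrue e) + ind (bothTrue e)) (ind ∘ mismatch)) ⟩
    sumFin m (λ e → ind (bothTrue e) + ind (bothTrue e) + ind (mismatch e))
      ≡⟨ sumFin-cong m (λ e → pointwise (b (π ⟨$⟩ʳ e)) (b e)) ⟩
    sumFin m (λ e → ind (b (π ⟨$⟩ʳ e)) + ind (b e))
      ≡⟨ sumFin-+ m (ind ∘ b ∘ (π ⟨$⟩ʳ_)) (ind ∘ b) ⟩
    count m (b ∘ (π ⟨$⟩ʳ_)) + count m b
      ≡⟨ cong (_+ count m b) (sumFin-permute m (ind ∘ b) π) ⟩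
    count m b + count m b ∎
    where open ≡-Reasoning

length≡count-∧nxt+2count-not : ∀ m (s : Fin (suc m) → Bool) → (∀ e → s e ∨ s (nxt e) ≡ true) →
  suc m ≡ count (suc m) (λ e → s e ∧ s (nxt e)) + (count (suc m) (not ∘ s) + count (suc m) (not ∘ s))
length≡count-∧nxt+2count-not m s no-two-falses = begin
  suc m
    ≡⟨ sym (count-const-true (suc m)) ⟩
  sumFin (suc m) (λ _ → 1)
    ≡⟨ sumFin-cong (suc m) (λ e → sym (pointwise (s e) (s (nxt e)) (no-two-falses e))) ⟩
  sumFin (suc m) (λ e → ind (s e ∧ s (nxt e)) + (ind (not (s e)) + ind (not (s (nxt e)))))
    ≡⟨ sumFin-+ (suc m) (λ e → ind (s e ∧ s (nxt e))) (λ e → ind (not (s e)) + ind (not (s (nxt e)))) ⟩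
  both + sumFin (suc m) (λ e → ind (not (s e)) + ind (not (s (nxt e))))
    ≡⟨ cong (both +_) (sumFin-+ (suc m) (ind ∘ not ∘ s) (ind ∘ not ∘ s ∘ nxt)) ⟩
  both + (count (suc m) (not ∘ s) + count (suc m) (not ∘ s ∘ nxt))
    ≡⟨ cong (λ x → both + (count (suc m) (not ∘ s) + x)) (sumFin-permute (suc m) (ind ∘ not ∘ s) rotation) ⟩
  both + (count (suc m) (not ∘ s) + count (suc m) (not ∘ s)) ∎
  where
  open ≡-Reasoning
  both : ℕ
  both = count (suc m) (λ e → s e ∧ s (nxt e))
  pointwise : ∀ x y → x ∨ y ≡ true → ind (x ∧ y) + (ind (not x) + ind (not y)) ≡ 1
  pointwise false true  _ = refl
  pointwise true  false _ = refl
  pointwise true  true  _ = refl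

sameAsPrev : (Fin (suc m) → Bool) → Fin (suc m) → Bool
sameAsPrev col e = does (col (prv e) Bool.≟ col e)

sameAsNeighbours : (Fin (suc m) → Bool) → Fin (suc m) → Bool
sameAsNeighbours col e = sameAsPrev col e ∧ sameAsPrev col (nxt e)

sameAsNeighbours-between : (col : Fin (suc m) → Bool) {j : Fin (suc m)} →
  sameAsNeighbours col (prv j) ≡ true → sameAsNeighbours col (nxt j) ≡ true → sameAsNeighbours col j ≡ true
sameAsNeighbours-between col {j} before after = cong₂ _∧_
  (subst (λ x → sameAsPrev col x ≡ true) (nxt-prv j) (∧-conicalʳ _ _ before))
  (∧-conicalˡ _ _ after)

module _ {m} (Ed : EdgeSet (Cycle (suc m))) (col : Fin (suc m) → Bool)
         (differ : NeighbourWeightsDiffer Ed col) where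

  private
    ifSame : Bool → Fin (suc m) → ℕ
    ifSame b x = if b then mult (Cycle (suc m)) Ed x else 0

    does-≟-comm : ∀ x y → does (x Bool.≟ y) ≡ does (y Bool.≟ x)
    does-≟-comm false false = refl
    does-≟-comm false true  = refl
    does-≟-comm true  false = refl
    does-≟-comm true  true  = refl

    differ′ : ∀ e → ifSame (sameAsPrev col e) (prv e) ≢ ifSame (sameAsPrev col (nxt e)) (nxt e)
    differ′ e = subst (λ b → ifSame (sameAsPrev col e) (prv e) ≢ ifSame b (nxt e))
      (trans (does-≟-comm (col (nxt e)) (col e))
             (cong (λ x → does (col x Bool.≟ col (nxt e))) (sym (prv-nxt e))))
      (differ e)

    mults≢⇒doubled : ∀ {a b} → (if a then 2 else 1) ≢ (if b then 2 else 1) → a ≡ true ⊎ b ≡ true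
    mults≢⇒doubled {true}              _  = inj₁ refl
    mults≢⇒doubled {false} {true}      _  = inj₂ refl
    mults≢⇒doubled {false} {false} 1≢1 = ⊥-elim (1≢1 refl)

  no-consecutive-changes : ∀ e → sameAsPrev col e ∨ sameAsPrev col (nxt e) ≡ true
  no-consecutive-changes e with sameAsPrev col e | sameAsPrev col (nxt e) | differ′ e
  ... | true  | _     | _   = refl
  ... | false | true  | _   = refl
  ... | false | false | 0≢0 = ⊥-elim (0≢0 refl)

  sameAsNeighbours⇒doubledNeighbour : ∀ {e} → sameAsNeighbours col e ≡ true →
                                      Ed (prv e) ≡ true ⊎ Ed (nxt e) ≡ true
  sameAsNeighbours⇒doubledNeighbour {e} same = mults≢⇒doubled
    (subst₂ (λ b b′ → ifSame b (prv e) ≢ ifSame b′ (nxt e))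
            (∧-conicalˡ (sameAsPrev col e) (sameAsPrev col (nxt e)) same)
            (∧-conicalʳ (sameAsPrev col e) (sameAsPrev col (nxt e)) same)
            (differ′ e))

  sameAsNeighbours⇒nextToDoubled : ∀ {e} → sameAsNeighbours col e ≡ true →
                                   ∃ λ j → Ed j ≡ true × (e ≡ nxt j ⊎ e ≡ prv j)
  sameAsNeighbours⇒nextToDoubled {e} same with sameAsNeighbours⇒doubledNeighbour same
  ... | inj₁ Ed-prv = prv e , Ed-prv , inj₁ (sym (nxt-prv e))
  ... | inj₂ Ed-nxt = nxt e , Ed-nxt , inj₂ (sym (prv-nxt e))

  module _ (1≤m : 1 ≤ m) (Ed-unique : ∀ {a b} → Ed a ≡ true → Ed b ≡ true → a ≡ b) where

    ¬sameAsNeighbours-around-doubled : ∀ {j} → Ed j ≡ true →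
      sameAsNeighbours col (prv j) ≡ true → sameAsNeighbours col (nxt j) ≡ true → ⊥
    ¬sameAsNeighbours-around-doubled {j} Ed-j before after
      with sameAsNeighbours⇒doubledNeighbour (sameAsNeighbours-between col before after)
    ... | inj₁ Ed-prv = prv≢ 1≤m j (Ed-unique Ed-prv Ed-j)
    ... | inj₂ Ed-nxt = nxt≢ 1≤m j (Ed-unique Ed-nxt Ed-j)

    sameAsNeighbours-unique : ∀ {a b} → sameAsNeighbours col a ≡ true → sameAsNeighbours col b ≡ true → a ≡ b
    sameAsNeighbours-unique same-a same-b
      with sameAsNeighbours⇒nextToDoubled same-a | sameAsNeighbours⇒nextToDoubled same-b
    ... | j , Ed-j , a≡ | k , Ed-k , b≡ with Ed-unique Ed-j Ed-k
    ... | refl with a≡ | b≡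
    ...   | inj₁ refl | inj₁ refl = refl
    ...   | inj₂ refl | inj₂ refl = refl
    ...   | inj₁ refl | inj₂ refl = ⊥-elim (¬sameAsNeighbours-around-doubled Ed-j same-b same-a)
    ...   | inj₂ refl | inj₁ refl = ⊥-elim (¬sameAsNeighbours-around-doubled Ed-j same-a same-b)

  length-mod4≡count-sameAsNeighbours-mod4 : suc m % 4 ≡ count (suc m) (sameAsNeighbours col) % 4
  length-mod4≡count-sameAsNeighbours-mod4 with count-mismatches-even (suc m) (flip rotation) col
  ... | divides k changes≡k*2 = begin
    suc m % 4
      ≡⟨ cong (_% 4) (length≡count-∧nxt+2count-not m (sameAsPrev col) no-consecutive-changes) ⟩
    (uniform + (changes + changes)) % 4
      ≡⟨ cong (λ x → (uniform + x) % 4) (cong₂ _+_ changes≡k*2 changes≡k*2) ⟩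
    (uniform + (k * 2 + k * 2)) % 4
      ≡⟨ cong (λ x → (uniform + x) % 4) (sym (*-distribˡ-+ k 2 2)) ⟩
    (uniform + k * 4) % 4
      ≡⟨ [m+kn]%n≡m%n uniform k 4 ⟩
    uniform % 4 ∎
    where
    open ≡-Reasoning
    uniform changes : ℕ
    uniform = count (suc m) (sameAsNeighbours col)
    changes = count (suc m) (not ∘ sameAsPrev col)

count-sameAsNeighbours≤size : 1 ≤ m → (Ed : EdgeSet (Cycle (suc m))) (col : Fin (suc m) → Bool) →
  NeighbourWeightsDiffer Ed col → count (suc m) Ed ≤ 1 →
  count (suc m) (sameAsNeighbours col) ≤ count (suc m) Ed
count-sameAsNeighbours≤size {m} 1≤m Ed col differ size≤1 with m≤n⇒m<n∨m≡n size≤1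
... | inj₂ size≡1 = subst (count (suc m) (sameAsNeighbours col) ≤_) (sym size≡1)
  (unique⇒count≤1 (suc m)
    (sameAsNeighbours-unique Ed col differ 1≤m (count≤1⇒unique (suc m) {Ed} size≤1)))
... | inj₁ (s≤s size≤0) = subst (_≤ count (suc m) Ed) (sym (count-allFalse (suc m) none)) z≤n
  where
  none : ∀ e → sameAsNeighbours col e ≡ false
  none e with sameAsNeighbours col e in same
  ... | false = refl
  ... | true with sameAsNeighbours⇒nextToDoubled Ed col differ same
  ...   | j , Ed-j , _ with () ← trans (sym Ed-j) (count≡0⇒allFalse (suc m) {Ed} (n≤0⇒n≡0 size≤0) j)

length-mod4≤size : 1 ≤ m → (Ed : EdgeSet (Cycle (suc m))) → Good (Cycle (suc m)) Ed →
                   size (Cycle (suc m)) Ed ≤ 1 → suc m % 4 ≤ size (Cycle (suc m)) Ed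
length-mod4≤size {m} 1≤m Ed (col , locIrr) size≤1 = begin
  suc m % 4   ≡⟨ length-mod4≡count-sameAsNeighbours-mod4 Ed col differ ⟩
  uniform % 4 ≡⟨ m<n⇒m%n≡m (s≤s (≤-trans (≤-trans uniform≤size size≤1) (s≤s z≤n))) ⟩
  uniform     ≤⟨ uniform≤size ⟩
  size (Cycle (suc m)) Ed ∎
  where
  open ≤-Reasoning
  differ : NeighbourWeightsDiffer Ed col
  differ = Equivalence.to (locIrr⇔neighbourWeightsDiffer Ed col) locIrr
  uniform : ℕ
  uniform = count (suc m) (sameAsNeighbours col)
  uniform≤size : uniform ≤ size (Cycle (suc m)) Ed
  uniform≤size = count-sameAsNeighbours≤size 1≤m Ed col differ size≤1

lowerBound : 1 ≤ m → (Ed : EdgeSet (Cycle (suc m))) → Good (Cycle (suc m)) Ed →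
             suc m % 4 ⊓ 2 ≤ size (Cycle (suc m)) Ed
lowerBound {m} 1≤m Ed good with size (Cycle (suc m)) Ed ≤? 1
... | yes size≤1 = ≤-trans (m⊓n≤m (suc m % 4) 2) (length-mod4≤size 1≤m Ed good size≤1)
... | no  size≰1 = ≤-trans (m⊓n≤n (suc m % 4) 2) (≰⇒> size≰1)

sideWeight : Bool → Bool → Bool → ℕ
sideWeight c colour doubled = if does (colour Bool.≟ c) then (if doubled then 2 else 1) else 0

-- NeighbourWeightsDiffer Ed col at e unfolds to IrregularBetween applied to the colours of
-- prv e, e, nxt e and the doublings of prv e, nxt e.
IrregularBetween : Bool → Bool → Bool → Bool → Bool → Set
IrregularBetween cₚ c cₙ dₚ dₙ = sideWeight c cₚ dₚ ≢ sideWeight c cₙ dₙ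

oneSameSide⇒irregularBetween : ∀ cₚ c cₙ dₚ dₙ → does (cₚ Bool.≟ c) ≢ does (cₙ Bool.≟ c) →
                               IrregularBetween cₚ c cₙ dₚ dₙ
oneSameSide⇒irregularBetween cₚ c cₙ dₚ dₙ = weights≢ (does (cₚ Bool.≟ c)) (does (cₙ Bool.≟ c)) dₚ dₙ
  where
  weights≢ : ∀ sₚ sₙ dₚ dₙ → sₚ ≢ sₙ →
             (if sₚ then (if dₚ then 2 else 1) else 0) ≢ (if sₙ then (if dₙ then 2 else 1) else 0)
  weights≢ true  true  _     _     s≢ = ⊥-elim (s≢ refl)
  weights≢ false false _     _     s≢ = ⊥-elim (s≢ refl)
  weights≢ true  false true  _     _  ()
  weights≢ true  false false _     _  ()
  weights≢ false true  _     true  _  ()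
  weights≢ false true  _     false _  ()

SeqIrregularAt : (ℕ → Bool) → (ℕ → Bool) → ℕ → ℕ → ℕ → Set
SeqIrregularAt col doubled p i n = IrregularBetween (col p) (col i) (col n) (doubled p) (doubled n)

SeqIrregularAt-cong : ∀ col doubled {p p′ i i′ n n′} → p ≡ p′ → i ≡ i′ → n ≡ n′ →
                      SeqIrregularAt col doubled p′ i′ n′ → SeqIrregularAt col doubled p i n
SeqIrregularAt-cong col doubled refl refl refl irr = irr

neighbourWeightsDiffer-fromSeq : ∀ k (col doubled : ℕ → Bool) →
  SeqIrregularAt col doubled k (suc k) 0 → SeqIrregularAt col doubled (suc k) 0 1 →
  (∀ i → SeqIrregularAt col doubled i (suc i) (suc (suc i))) →
  NeighbourWeightsDiffer {suc k} (doubled ∘ toℕ) (col ∘ toℕ)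
neighbourWeightsDiffer-fromSeq k col doubled atLast atFirst inside zero =
  SeqIrregularAt-cong col doubled (toℕ-fromℕ (suc k)) refl (cong toℕ (nxt-inject₁ {suc k} zero)) atFirst
neighbourWeightsDiffer-fromSeq k col doubled atLast atFirst inside (suc i) with view i
... | ‵fromℕ     = SeqIrregularAt-cong col doubled (trans (toℕ-inject₁ (fromℕ k)) (toℕ-fromℕ k))
                    (cong suc (toℕ-fromℕ k)) (cong toℕ (nxt-fromℕ (suc k))) atLast
... | ‵inject₁ j = SeqIrregularAt-cong col doubled (trans (toℕ-inject₁ (inject₁ j)) (toℕ-inject₁ j))
                    (cong suc (toℕ-inject₁ j)) (cong toℕ (nxt-inject₁ (suc j))) (inside (toℕ j))

goodFromSeq : ∀ k (col doubled : ℕ → Bool) →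
  SeqIrregularAt col doubled k (suc k) 0 → SeqIrregularAt col doubled (suc k) 0 1 →
  (∀ i → SeqIrregularAt col doubled i (suc i) (suc (suc i))) →
  Good (Cycle (suc (suc k))) (doubled ∘ toℕ)
goodFromSeq k col doubled atLast atFirst inside =
  col ∘ toℕ ,
  Equivalence.from (locIrr⇔neighbourWeightsDiffer (doubled ∘ toℕ) (col ∘ toℕ))
                   (neighbourWeightsDiffer-fromSeq k col doubled atLast atFirst inside)

pairs : ℕ → Bool
pairs 0 = true
pairs 1 = true
pairs 2 = false
pairs 3 = false
pairs (suc (suc (suc (suc i)))) = pairs i

pairs-periodic : ∀ i q → pairs (i + q * 4) ≡ pairs i
pairs-periodic i q = trans (cong pairs (+-comm i (q * 4))) (shift q)
  where
  shift : ∀ q → pairs (q * 4 + i) ≡ pairs i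
  shift zero    = refl
  shift (suc q) = shift q

pairs-oneSameSide : ∀ i → does (pairs i Bool.≟ pairs (suc i)) ≢ does (pairs (suc (suc i)) Bool.≟ pairs (suc i))
pairs-oneSameSide 0 ()
pairs-oneSameSide 1 ()
pairs-oneSameSide 2 ()
pairs-oneSameSide 3 ()
pairs-oneSameSide (suc (suc (suc (suc i)))) = pairs-oneSameSide i

pairs-irregular : ∀ doubled i → SeqIrregularAt pairs doubled i (suc i) (suc (suc i))
pairs-irregular doubled i =
  oneSameSide⇒irregularBetween (pairs i) (pairs (suc i)) (pairs (suc (suc i))) (doubled i) (doubled (suc (suc i)))
                               (pairs-oneSameSide i)

GoodOfSize : Graph → ℕ → Set
GoodOfSize G k = Σ (EdgeSet G) λ Ed → size G Ed ≡ k × Good G Ed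

good-C[4+4q] : ∀ q → GoodOfSize (Cycle (4 + q * 4)) 0
good-C[4+4q] q = doubled ∘ toℕ , count-allFalse (4 + q * 4) (λ _ → refl) ,
  goodFromSeq (2 + q * 4) pairs doubled atLast atFirst (pairs-irregular doubled)
  where
  doubled : ℕ → Bool
  doubled _ = false
  atLast : SeqIrregularAt pairs doubled (2 + q * 4) (3 + q * 4) 0
  atLast = subst₂ (λ cₚ c → IrregularBetween cₚ c true false false)
    (sym (pairs-periodic 2 q)) (sym (pairs-periodic 3 q)) (λ ())
  atFirst : SeqIrregularAt pairs doubled (3 + q * 4) 0 1
  atFirst = subst (λ cₚ → IrregularBetween cₚ true true false false)
    (sym (pairs-periodic 3 q)) (λ ())

-- Where the pattern wraps around, the colours form a run of 3, 4 or 5 equal edges (n ≡ 1, 2, 3 mod 4);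
-- the doubled edges are placed so that inside the run every edge has neighbours of different multiplicity.
good-C[5+4q] : ∀ q → GoodOfSize (Cycle (5 + q * 4)) 1
good-C[5+4q] q = doubled ∘ toℕ , cong suc (count-allFalse (3 + q * 4) (λ _ → refl)) ,
  goodFromSeq (3 + q * 4) pairs doubled atLast atFirst (pairs-irregular doubled)
  where
  doubled : ℕ → Bool
  doubled i = i ≡ᵇ 1
  atLast : SeqIrregularAt pairs doubled (3 + q * 4) (4 + q * 4) 0
  atLast = subst₂ (λ cₚ c → IrregularBetween cₚ c true false false)
    (sym (pairs-periodic 3 q)) (sym (pairs-periodic 0 q)) (λ ())
  atFirst : SeqIrregularAt pairs doubled (4 + q * 4) 0 1
  atFirst = subst (λ cₚ → IrregularBetween cₚ true true false true)
    (sym (pairs-periodic 0 q)) (λ ())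

good-C[6+4q] : ∀ q → GoodOfSize (Cycle (6 + q * 4)) 2
good-C[6+4q] q = doubled ∘ toℕ , cong (2 +_) (count-allFalse (4 + q * 4) (λ _ → refl)) ,
  goodFromSeq (4 + q * 4) pairs doubled atLast atFirst (pairs-irregular doubled)
  where
  doubled : ℕ → Bool
  doubled i = i <ᵇ 2
  atLast : SeqIrregularAt pairs doubled (4 + q * 4) (5 + q * 4) 0
  atLast = subst₂ (λ cₚ c → IrregularBetween cₚ c true false true)
    (sym (pairs-periodic 0 q)) (sym (pairs-periodic 1 q)) (λ ())
  atFirst : SeqIrregularAt pairs doubled (5 + q * 4) 0 1
  atFirst = subst (λ cₚ → IrregularBetween cₚ true true false true)
    (sym (pairs-periodic 1 q)) (λ ())

good-C[7+4q] : ∀ q → GoodOfSize (Cycle (7 + q * 4)) 2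
good-C[7+4q] q = doubled ∘ toℕ , cong (2 +_) (count-allFalse (5 + q * 4) (λ _ → refl)) ,
  goodFromSeq (5 + q * 4) col doubled atLast atFirst inside
  where
  col : ℕ → Bool
  col 0 = true
  col 1 = true
  col 2 = true
  col (suc (suc (suc i))) = pairs i
  doubled : ℕ → Bool
  doubled i = (i ≡ᵇ 1) ∨ (i ≡ᵇ 2)
  atLast : SeqIrregularAt col doubled (5 + q * 4) (6 + q * 4) 0
  atLast = subst₂ (λ cₚ c → IrregularBetween cₚ c true false false)
    (sym (pairs-periodic 2 q)) (sym (pairs-periodic 3 q)) (λ ())
  atFirst : SeqIrregularAt col doubled (6 + q * 4) 0 1
  atFirst = subst (λ cₚ → IrregularBetween cₚ true true false true)
    (sym (pairs-periodic 3 q)) (λ ())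
  inside : ∀ i → SeqIrregularAt col doubled i (suc i) (suc (suc i))
  inside 0 = λ ()
  inside 1 = λ ()
  inside 2 = λ ()
  inside (suc (suc (suc i))) = pairs-irregular (λ _ → false) i

good-C[r+4+4q] : ∀ r q → r < 4 → GoodOfSize (Cycle (r + 4 + q * 4)) (r ⊓ 2)
good-C[r+4+4q] 0 q _ = good-C[4+4q] q
good-C[r+4+4q] 1 q _ = good-C[5+4q] q
good-C[r+4+4q] 2 q _ = good-C[6+4q] q
good-C[r+4+4q] 3 q _ = good-C[7+4q] q
good-C[r+4+4q] (suc (suc (suc (suc _)))) q (s≤s (s≤s (s≤s (s≤s ()))))

upperBound : ∀ n → 4 ≤ n → GoodOfSize (Cycle n) (n % 4 ⊓ 2)
upperBound n 4≤n with n / 4 | m≥n⇒m/n>0 {n} {4} 4≤n | m≡m%n+[m/n]*n n 4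
... | suc q | _ | n≡r+[q+1]*4 =
  subst (λ x → GoodOfSize (Cycle x) (n % 4 ⊓ 2)) (sym (trans n≡r+[q+1]*4 (sym (+-assoc (n % 4) 4 (q * 4)))))
        (good-C[r+4+4q] (n % 4) q (m%n<n n 4))

Dlir-Cycle : ∀ n → 4 ≤ n → DlirIs (Cycle n) (n % 4 ⊓ 2)
Dlir-Cycle n@(suc m) 4≤n@(s≤s 3≤m) = upperBound n 4≤n , lowerBound (≤-trans (s≤s z≤n) 3≤m)

mainTheorem2 : (n : ℕ) → 4 ≤ n →
    (n % 4 ≡ 0 → DlirIs (Cycle n) 0)
    × (n % 4 ≡ 1 → DlirIs (Cycle n) 1)
    × (n % 4 ≡ 2 ⊎ n % 4 ≡ 3 → DlirIs (Cycle n) 2)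
mainTheorem2 n 4≤n = Dlir-mod4 0 , Dlir-mod4 1 , [ Dlir-mod4 2 , Dlir-mod4 3 ]
  where
  Dlir-mod4 : ∀ r → n % 4 ≡ r → DlirIs (Cycle n) (r ⊓ 2)
  Dlir-mod4 r n%4≡r = subst (λ x → DlirIs (Cycle n) (x ⊓ 2)) n%4≡r (Dlir-Cycle n 4≤n)
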